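{- Let $n$ be a positive integer and $q=(q_1,\ldots,q_{d-1},n)\in\mathbb{Z}^d$, set $q_d=1-\sum_{j=1}^{d-1}q_j$, and assume $q_i\mid n$ for every $i=1,\ldots,d$. Then $$L(x)=\sum_{j=0}^{n-1}x^{\left\lceil\frac{q_1j+q_1^+}{n}\right\rceil+\cdots+\left\lceil\frac{q_dj+q_d^+}{n}\right\rceil}$$ is a polynomial of degree at most $d$ and at least $1$.
   Context: For integer $a$, $a^+=\max(0,a)$. -}

module Defs where

open import Data.Nat as ℕ using (ℕ; NonZero)
open import Data.Integer using (ℤ; +_; -_; _+_; _-_; _*_; _⊔_; _/ℕ_; _≟_)
open import Data.Fin using (Fin)
open import Data.List using (List; []; _∷_; _++_; [_]; map; upTo; filter; length; foldr)
import Data.Vec.Functional as VF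

sumℤ : List ℤ → ℤ
sumℤ = foldr _+_ (+ 0)

_⁺ : ℤ → ℤ
a ⁺ = + 0 ⊔ a

-- ⌈ a / n ⌉ for n > 0  (floor division _/ℕ_ of the stdlib, negated twice)
⌈_/_⌉ : ℤ → (n : ℕ) → .{{NonZero n}} → ℤ
⌈ a / n ⌉ = - ((- a) /ℕ n)

-- Given q₁,…,q_{d-1} (here d = suc m), the full list (q₁,…,q_{d-1},q_d)
-- with q_d = 1 - Σ_{j<d} q_j.
qd : (m : ℕ) → (Fin m → ℤ) → ℤ
qd m q = + 1 - sumℤ (VF.toList q)

weights : (m : ℕ) → (Fin m → ℤ) → List ℤ
weights m q = VF.toList q ++ [ qd m q ]

expo : (m n : ℕ) → .{{NonZero n}} → (Fin m → ℤ) → ℕ → ℤ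
expo m n q j = sumℤ (map (λ qi → ⌈ qi * + j + qi ⁺ / n ⌉) (weights m q))

-- L(x) = Σ_{j=0}^{n-1} x^{expo j}, as a Laurent polynomial given by its
-- coefficient function: coefficient of x^k = #{ j < n | expo j = k }.
coeffL : (m n : ℕ) → .{{NonZero n}} → (Fin m → ℤ) → ℤ → ℕ
coeffL m n q k = length (filter (λ j → expo m n q j ≟ k) (upTo n))

{-# OPTIONS --safe #-}
-- Fix i and j, put a = q_i j + q_i⁺ and let r = n⌈a/n⌉ - a ∈ [0, n).  Since q_i divides n and a,
-- it divides n - r > 0, so |q_i| + r ≤ n; together with q_i ≤ q_i⁺ ≤ |q_i| this gives
--   q_i (j + 1) ≤ n⌈(q_i j + q_i⁺)/n⌉ ≤ q_i j + n.
-- Summing over i with Σ q_i = 1 yields j + 1 ≤ n e_j ≤ j + d n for the exponent e_j of the j-th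
-- monomial, hence 1 ≤ e_j ≤ d whenever 0 ≤ j < n.
module Submission where

open import Defs
open import Data.Nat using (ℕ; NonZero; suc)
open import Data.Integer using (ℤ; +_; _<_; _≤_)
open import Data.Integer.Divisibility using (_∣_)
open import Data.Fin using (Fin)
open import Data.List.Relation.Unary.All using (All)
open import Data.Product using (_×_; ∃-syntax)
open import Relation.Binary.PropositionalEquality using (_≡_; _≢_)

import Data.Nat as ℕ
import Data.Nat.Properties as ℕ
import Data.Nat.Divisibility as ℕ
open import Data.Integer using (-[1+_]; -_; _+_; _-_; _*_; ∣_∣; _/ℕ_; _%ℕ_; _⊖_; _≟_; +≤+; +<+)
open import Data.Integer.Properties
open import Data.Integer.DivMod using (a≡a%ℕn+[a/ℕn]*n; n%ℕd<d)
import Data.Integer.Divisibility.Signed as Signed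
open import Data.Integer.Tactic.RingSolver using (solve-∀)
open import Data.List using ([]; _∷_; _++_; [_]; map; upTo; filter; length)
import Data.List.Properties as List
open import Data.List.Relation.Unary.All using ([]; _∷_)
import Data.List.Relation.Unary.All as All
import Data.List.Relation.Unary.All.Properties as AllP
import Data.List.Relation.Unary.Any.Properties as Any
import Data.Vec.Functional as VF
open import Data.Product using (_,_)
open import Function using (id)
open import Relation.Binary.PropositionalEquality
  using (refl; sym; trans; cong; cong₂; subst; module ≡-Reasoning)

i⁺≤∣i∣ : ∀ i → i ⁺ ≤ + ∣ i ∣
i⁺≤∣i∣ (+ _)    = ≤-refl
i⁺≤∣i∣ -[1+ _ ] = +≤+ ℕ.z≤n

i∣i⁺ : ∀ i → i Signed.∣ i ⁺
i∣i⁺ (+ _)    = Signed.∣-refl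
i∣i⁺ -[1+ _ ] = Signed.∣ᵤ⇒∣ (ℕ._∣0 _)

ceilGap : ℤ → (n : ℕ) → .{{NonZero n}} → ℕ
ceilGap a n = (- a) %ℕ n

module _ {n : ℕ} .{{_ : NonZero n}} where

  ceilGap<n : ∀ a → ceilGap a n ℕ.< n
  ceilGap<n a = n%ℕd<d (- a) n

  n*⌈a/n⌉≡a+ceilGap : ∀ a → + n * ⌈ a / n ⌉ ≡ a + + ceilGap a n
  n*⌈a/n⌉≡a+ceilGap a = begin
    + n * - Q               ≡⟨ negate-quotient (+ n) Q (+ r) ⟩
    - (+ r + Q * + n) + + r ≡⟨ cong (λ t → - t + + r) (a≡a%ℕn+[a/ℕn]*n (- a) n) ⟨
    - (- a) + + r           ≡⟨ cong (_+ + r) (neg-involutive a) ⟩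
    a + + r                 ∎
    where
    open ≡-Reasoning
    Q = (- a) /ℕ n
    r = ceilGap a n
    negate-quotient : ∀ (n Q r : ℤ) → n * - Q ≡ - (r + Q * n) + r
    negate-quotient = solve-∀

  a≤n*⌈a/n⌉ : ∀ a → a ≤ + n * ⌈ a / n ⌉
  a≤n*⌈a/n⌉ a = ≤-trans (i≤i+j a (+ ceilGap a n)) (≤-reflexive (sym (n*⌈a/n⌉≡a+ceilGap a)))

  ∣q∣+ceilGap≤n : ∀ {q a} → q Signed.∣ + n → q Signed.∣ a → ∣ q ∣ ℕ.+ ceilGap a n ℕ.≤ n
  ∣q∣+ceilGap≤n {q} {a} q∣n q∣a =
    ℕ.m≤o∸n⇒m+n≤o ∣ q ∣ r≤n (ℕ.∣⇒≤ {{ℕ.>-nonZero (ℕ.m<n⇒0<n∸m r<n)}} q∣n∸r)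
    where
    r = ceilGap a n
    r<n = ceilGap<n a
    r≤n = ℕ.<⇒≤ r<n
    shift : ∀ (x y a : ℤ) → x - y ≡ x + a - (a + y)
    shift = solve-∀
    n∸r≡ : + (n ℕ.∸ r) ≡ + n + a - + n * ⌈ a / n ⌉
    n∸r≡ = begin
      + (n ℕ.∸ r)               ≡⟨ ⊖-≥ r≤n ⟨
      n ⊖ r                     ≡⟨ m-n≡m⊖n n r ⟨
      + n - + r                 ≡⟨ shift (+ n) (+ r) a ⟩
      + n + a - (a + + r)       ≡⟨ cong (λ t → + n + a - t) (n*⌈a/n⌉≡a+ceilGap a) ⟨
      + n + a - + n * ⌈ a / n ⌉ ∎
      where open ≡-Reasoning
    q∣n∸r : ∣ q ∣ ℕ.∣ n ℕ.∸ r
    q∣n∸r = Signed.∣⇒∣ᵤ (subst (q Signed.∣_) (sym n∸r≡)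
      (Signed.∣m∣n⇒∣m-n (Signed.∣m∣n⇒∣m+n q∣n q∣a) (Signed.∣m⇒∣m*n _ q∣n)))

  q*[1+j]≤n*⌈[qj+q⁺]/n⌉ : ∀ q j → q * + suc j ≤ + n * ⌈ q * + j + q ⁺ / n ⌉
  q*[1+j]≤n*⌈[qj+q⁺]/n⌉ q j = begin
    q * + suc j                 ≡⟨ *-suc q (+ j) ⟩
    q + q * + j                 ≡⟨ +-comm q (q * + j) ⟩
    q * + j + q                 ≤⟨ +-monoʳ-≤ (q * + j) (i≤j⊔i (+ 0) q) ⟩
    q * + j + q ⁺               ≤⟨ a≤n*⌈a/n⌉ (q * + j + q ⁺) ⟩
    + n * ⌈ q * + j + q ⁺ / n ⌉ ∎
    where open ≤-Reasoning

  n*⌈[qj+q⁺]/n⌉≤qj+n : ∀ q j → q ∣ + n → + n * ⌈ q * + j + q ⁺ / n ⌉ ≤ q * + j + + n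
  n*⌈[qj+q⁺]/n⌉≤qj+n q j q∣n = begin
    + n * ⌈ a / n ⌉           ≡⟨ n*⌈a/n⌉≡a+ceilGap a ⟩
    q * + j + q ⁺ + + r       ≡⟨ +-assoc (q * + j) (q ⁺) (+ r) ⟩
    q * + j + (q ⁺ + + r)     ≤⟨ +-monoʳ-≤ (q * + j) (+-monoˡ-≤ (+ r) (i⁺≤∣i∣ q)) ⟩
    q * + j + + (∣ q ∣ ℕ.+ r) ≤⟨ +-monoʳ-≤ (q * + j) (+≤+ (∣q∣+ceilGap≤n (Signed.∣ᵤ⇒∣ q∣n) q∣a)) ⟩
    q * + j + + n             ∎
    where
    open ≤-Reasoning
    a = q * + j + q ⁺
    r = ceilGap a n
    q∣a : q Signed.∣ a
    q∣a = Signed.∣m∣n⇒∣m+n (Signed.∣m⇒∣m*n (+ j) Signed.∣-refl) (i∣i⁺ q)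

sumℤ-++ : ∀ xs ys → sumℤ (xs ++ ys) ≡ sumℤ xs + sumℤ ys
sumℤ-++ []       ys = sym (+-identityˡ (sumℤ ys))
sumℤ-++ (x ∷ xs) ys =
  trans (cong (λ s → x + s) (sumℤ-++ xs ys)) (sym (+-assoc x (sumℤ xs) (sumℤ ys)))

sumℤ-mono-≤ : ∀ {A : Set} {f g : A → ℤ} {xs} → All (λ x → f x ≤ g x) xs →
              sumℤ (map f xs) ≤ sumℤ (map g xs)
sumℤ-mono-≤ []            = ≤-refl
sumℤ-mono-≤ (fx≤gx ∷ f≤g) = +-mono-≤ fx≤gx (sumℤ-mono-≤ f≤g)

sumℤ-map-*ˡ : ∀ {A : Set} k (f : A → ℤ) xs → sumℤ (map (λ x → k * f x) xs) ≡ k * sumℤ (map f xs)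
sumℤ-map-*ˡ k f []       = sym (*-zeroʳ k)
sumℤ-map-*ˡ k f (x ∷ xs) =
  trans (cong (λ s → k * f x + s) (sumℤ-map-*ˡ k f xs))
        (sym (*-distribˡ-+ k (f x) (sumℤ (map f xs))))

sumℤ-map-*ʳ : ∀ k xs → sumℤ (map (_* k) xs) ≡ sumℤ xs * k
sumℤ-map-*ʳ k []       = sym (*-zeroˡ k)
sumℤ-map-*ʳ k (x ∷ xs) =
  trans (cong (λ s → x * k + s) (sumℤ-map-*ʳ k xs)) (sym (*-distribʳ-+ k x (sumℤ xs)))

sumℤ-map-affine : ∀ k c xs → sumℤ (map (λ x → x * k + c) xs) ≡ sumℤ xs * k + + length xs * c
sumℤ-map-affine k c []       = sym (+-identityʳ (+ 0 * k))
sumℤ-map-affine k c (x ∷ xs) =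
  trans (cong (λ s → x * k + c + s) (sumℤ-map-affine k c xs))
        (regroup x (sumℤ xs) k c (+ length xs))
  where
  regroup : ∀ (x s k c l : ℤ) → x * k + c + (s * k + l * c) ≡ (x + s) * k + (+ 1 + l) * c
  regroup = solve-∀

sumℤ-weights : ∀ m q → sumℤ (weights m q) ≡ + 1
sumℤ-weights m q = trans (sumℤ-++ (VF.toList q) [ qd m q ]) (cancel (sumℤ (VF.toList q)))
  where
  cancel : ∀ (s : ℤ) → s + ((+ 1 - s) + + 0) ≡ + 1
  cancel = solve-∀

length-weights : ∀ m q → length (weights m q) ≡ suc m
length-weights m q = begin
  length (VF.toList q ++ [ qd m q ]) ≡⟨ List.length-++ (VF.toList q) ⟩
  length (VF.toList q) ℕ.+ 1         ≡⟨ cong (ℕ._+ 1) (List.length-tabulate q) ⟩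
  m ℕ.+ 1                            ≡⟨ ℕ.+-comm m 1 ⟩
  suc m                              ∎
  where open ≡-Reasoning

module _ (m n : ℕ) .{{_ : NonZero n}} (q : Fin m → ℤ) where

  private
    ws = weights m q

    n*expo≡sum : ∀ j → + n * expo m n q j ≡ sumℤ (map (λ qi → + n * ⌈ qi * + j + qi ⁺ / n ⌉) ws)
    n*expo≡sum j = sym (sumℤ-map-*ˡ (+ n) (λ qi → ⌈ qi * + j + qi ⁺ / n ⌉) ws)

  1+j≤n*expo : ∀ j → + suc j ≤ + n * expo m n q j
  1+j≤n*expo j = begin
    + suc j                                              ≡⟨ *-identityˡ (+ suc j) ⟨
    + 1 * + suc j                                        ≡⟨ cong (_* + suc j) (sumℤ-weights m q) ⟨
    sumℤ ws * + suc j                                    ≡⟨ sumℤ-map-*ʳ (+ suc j) ws ⟨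
    sumℤ (map (_* + suc j) ws)                           ≤⟨ sumℤ-mono-≤ (All.universal ceil≥ ws) ⟩
    sumℤ (map (λ qi → + n * ⌈ qi * + j + qi ⁺ / n ⌉) ws) ≡⟨ n*expo≡sum j ⟨
    + n * expo m n q j                                   ∎
    where
    open ≤-Reasoning
    ceil≥ : ∀ qi → qi * + suc j ≤ + n * ⌈ qi * + j + qi ⁺ / n ⌉
    ceil≥ qi = q*[1+j]≤n*⌈[qj+q⁺]/n⌉ qi j

  n*expo≤j+[1+m]n : All (_∣ + n) (weights m q) → ∀ j → + n * expo m n q j ≤ + j + + suc m * + n
  n*expo≤j+[1+m]n q∣n j = begin
    + n * expo m n q j                                   ≡⟨ n*expo≡sum j ⟩
    sumℤ (map (λ qi → + n * ⌈ qi * + j + qi ⁺ / n ⌉) ws) ≤⟨ sumℤ-mono-≤ (All.map (λ {qi} → ceil≤ qi) q∣n) ⟩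
    sumℤ (map (λ qi → qi * + j + + n) ws)                ≡⟨ sumℤ-map-affine (+ j) (+ n) ws ⟩
    sumℤ ws * + j + + length ws * + n                    ≡⟨ cong₂ (λ s l → s * + j + + l * + n)
                                                              (sumℤ-weights m q) (length-weights m q) ⟩
    + 1 * + j + + suc m * + n                            ≡⟨ cong (_+ + suc m * + n) (*-identityˡ (+ j)) ⟩
    + j + + suc m * + n                                  ∎
    where
    open ≤-Reasoning
    ceil≤ : ∀ qi → qi ∣ + n → + n * ⌈ qi * + j + qi ⁺ / n ⌉ ≤ qi * + j + + n
    ceil≤ qi = n*⌈[qj+q⁺]/n⌉≤qj+n qi j

  0<expo : ∀ j → + 0 < expo m n q j
  0<expo j = *-cancelˡ-<-nonNeg (+ n) (begin-strict
    + n * + 0          ≡⟨ *-zeroʳ (+ n) ⟩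
    + 0                <⟨ +<+ ℕ.z<s ⟩
    + suc j            ≤⟨ 1+j≤n*expo j ⟩
    + n * expo m n q j ∎)
    where open ≤-Reasoning

  expo≤1+m : All (_∣ + n) (weights m q) → ∀ {j} → j ℕ.< n → expo m n q j ≤ + suc m
  expo≤1+m q∣n {j} j<n = i<j⇒i≤pred[j] (*-cancelˡ-<-nonNeg (+ n) (begin-strict
    + n * expo m n q j   ≤⟨ n*expo≤j+[1+m]n q∣n j ⟩
    + j + + suc m * + n  <⟨ +-mono-<-≤ (+<+ j<n) (≤-refl {+ suc m * + n}) ⟩
    + n + + suc m * + n  ≡⟨ cong (λ t → + n + t) (*-comm (+ suc m) (+ n)) ⟩
    + n + + n * + suc m  ≡⟨ *-suc (+ n) (+ suc m) ⟨
    + n * + suc (suc m)  ∎))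
    where open ≤-Reasoning

length-filter-upTo≡0 : ∀ (f : ℕ → ℤ) n k → (∀ {j} → j ℕ.< n → f j ≢ k) →
                       length (filter (λ j → f j ≟ k) (upTo n)) ≡ 0
length-filter-upTo≡0 f n k f≢k =
  cong length (List.filter-none (λ j → f j ≟ k) (AllP.applyUpTo⁺₁ id n f≢k))

length-filter-upTo≢0 : ∀ (f : ℕ → ℤ) {n j} → j ℕ.< n →
                       length (filter (λ i → f i ≟ f j) (upTo n)) ≢ 0
length-filter-upTo≢0 f j<n =
  ℕ.n>0⇒n≢0 (List.filter-some (λ i → f i ≟ f _) (Any.applyUpTo⁺ id refl j<n))

proposition5p2 : (m n : ℕ) → .{{_ : NonZero n}} → (q : Fin m → ℤ) →
    All (λ qi → qi ∣ + n) (weights m q) →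
    ((k : ℤ) → k < + 0 → coeffL m n q k ≡ 0)
    × ((k : ℤ) → + suc m < k → coeffL m n q k ≡ 0)
    × (∃[ k ] (+ 1 ≤ k × coeffL m n q k ≢ 0))
proposition5p2 m n q q∣n =
    (λ k k<0 → length-filter-upTo≡0 e n k λ _ e≡k →
       <-asym k<0 (subst (+ 0 <_) e≡k (0<expo m n q _)))
  , (λ k 1+m<k → length-filter-upTo≡0 e n k λ j<n e≡k →
       <⇒≱ 1+m<k (subst (_≤ + suc m) e≡k (expo≤1+m m n q q∣n j<n)))
  , (e 0 , i<j⇒suc[i]≤j (0<expo m n q 0) , length-filter-upTo≢0 e (ℕ.>-nonZero⁻¹ n))
  where
  e = expo m n q
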